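{- Let $p$ be a prime with $p\le 3001$ and let $s$ be an integer with $2\le s\le 300$. For $n\ge 1$ let $H(s;n)=\sum_{k=1}^{n} k^{ -s}$ and $H(s;0)=0$. Then the $p$-divisible set $J(s|p)=\{n\in\mathbb{Z}_{\ge 0} : H(s;n)\equiv 0 \pmod p\}$ (i.e. the set of $n\ge 0$ with $H(s;n)=0$ or $v_p(H(s;n))>0$) is finite.
   Context: $v_p$ denotes the $p$-adic valuation on $\mathbb{Q}$; a rational number $x$ satisfies $x\equiv 0 \pmod p$ if $x=0$ or $v_p(x)\ge 1$. -}

module Defs where

open import Data.Nat using (ℕ; zero; suc; _^_; _<_)
open import Data.Nat.Divisibility using (_∣_)
open import Data.Nat.Properties using (m^n≢0)
open import Data.Integer using (+_; ∣_∣)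
open import Data.Rational using (ℚ; 0ℚ; _+_; _/_; ↥_)
open import Data.Product using (∃)
open import Data.Sum using (_⊎_)
open import Relation.Binary.PropositionalEquality using (_≡_)

-- the term k^{-s} for k ≥ 1, written with k = suc j
invPow : ℕ → ℕ → ℚ
invPow s j = (+ 1 / (suc j ^ s)) {{m^n≢0 (suc j) s}}

H : ℕ → ℕ → ℚ
H s zero    = 0ℚ
H s (suc n) = H s n + invPow s n

-- v_p(x) ≥ 1 for a nonzero rational x: writing x = a/b in lowest terms
-- (as ℚ is stored), v_p(x) ≥ 1 iff p divides the numerator a.
PosValuation : ℕ → ℚ → Set
PosValuation p x = p ∣ ∣ (↥ x) ∣

ZeroModP : ℕ → ℚ → Set
ZeroModP p x = (x ≡ 0ℚ) ⊎ PosValuation p x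

J : ℕ → ℕ → ℕ → Set
J s p n = ZeroModP p (H s n)

FiniteSet : (ℕ → Set) → Set
FiniteSet P = ∃ λ N → ∀ n → P n → n < N

module Submission where

-- Split H(s;n) according to the last base-p digit of the summation index:
-- the terms with p ∣ k add up to p^{-s} H(s;⌊n/p⌋) and all other terms are p-adic
-- units, so H(s;n) − p^{-s} H(s;⌊n/p⌋) is p-integral (Descent).  Hence p ∣ H(s;n)
-- forces p^s ∣ H(s;⌊n/p⌋).  Call m bad when p^s ∣ H(s;m): bad numbers are closed
-- under deleting the last digit, so if every bad one-digit m is exceptional and no
-- exceptional m has a bad child, every positive bad number has one digit and every
-- n ∈ J(s|p) has at most two, n < p² (Pruning).
-- The two finite hypotheses are established by computation: H(s;m) modulo p^E for
-- all 1 ≤ m < p and 2 ≤ s ≤ 300, for many primes at once modulo a product of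
-- prime powers (Kernel, Congruence, Certificates).  The only exceptions are
-- (p,s,m) = (7,2,3) and (37,3,36); their children are checked modulo p² (Children).

open import Defs
open import Data.Nat using (ℕ; _≤_)
open import Data.Nat.Primality using (Prime)

open import Data.Nat.Base as ℕ using (zero; suc; pred; _^_; _∸_; _⊓_; _<_; NonZero; z≤n; s≤s)
import Data.Nat.Properties as ℕP
open import Data.Nat.Divisibility as ℕD using (_∣_; divides)
open import Data.Nat.DivMod using (_/_; _%_; m≡m%n+[m/n]*n; m%n<n; m/n<m; m≥n⇒m/n>0)
open import Data.Nat.Induction using (<-rec)
open import Data.Nat.Primality using (euclidsLemma; ¬prime[1]; prime⇒nonZero; prime⇒nonTrivial; composite⇒¬prime)
open import Data.Nat.Coprimality as Coprimality using (Coprime)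
open import Data.Integer.Base as ℤ using (ℤ; +_; -[1+_])
import Data.Integer.Properties as ℤP
open import Data.Integer.Tactic.RingSolver using (solve-∀)
import Data.Nat.Tactic.RingSolver as ℕ-Solver
open import Data.Rational.Base as ℚ using (mkℚ; toℚᵘ)
import Data.Rational.Properties as ℚP
open import Data.Rational.Unnormalised.Base as Q using (ℚᵘ; mkℚᵘ; _≃_; *≡*; 0ℚᵘ; 1ℚᵘ)
open import Data.Rational.Unnormalised.Properties as QP using (≃-refl; ≃-sym; ≃-trans; ≃-reflexive)
open import Data.Rational.Unnormalised.Solver using (module +-*-Solver)
open import Data.Product.Base using (_×_; _,_; proj₁; proj₂; map₁)
open import Data.Sum.Base using (_⊎_; inj₁; inj₂; map₂)
open import Data.Empty using (⊥-elim)
open import Data.Unit.Base using (⊤; tt)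
open import Data.Bool.Base using (Bool; true; false; T; not; _∧_; _∨_)
import Data.Bool.Properties as BoolP
open import Data.Maybe.Base using (Maybe; just; nothing)
open import Data.List.Base using (List; []; _∷_; map; replicate; length)
import Data.List.Properties as ListP
open import Data.List.Membership.Propositional using (_∈_)
open import Data.List.Relation.Unary.Any using (here; there)
open import Data.List.Relation.Unary.All using (All; []; _∷_)
open import Function.Bundles using (Equivalence)
open import Relation.Nullary using (¬_; yes; no)
open import Relation.Binary.PropositionalEquality
  using (_≡_; refl; sym; trans; cong; cong₂; subst; module ≡-Reasoning)

open +-*-Solver using (solve; _:+_; _:-_; _:*_; :-_; _:=_; con)

ι : ℕ → ℚᵘ
ι n = mkℚᵘ (+ n) 0

recip : ℕ → ℚᵘ
recip d = mkℚᵘ (+ 1) (pred d)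

ι-+ : ∀ a b → ι (a ℕ.+ b) ≃ ι a Q.+ ι b
ι-+ a b = *≡* (trans (cong (ℤ._* + 1) (ℤP.pos-+ a b)) (unit-denominators (+ a) (+ b)))
  where
  unit-denominators : ∀ x y → (x ℤ.+ y) ℤ.* + 1 ≡ (x ℤ.* + 1 ℤ.+ y ℤ.* + 1) ℤ.* + 1
  unit-denominators = solve-∀

ι-* : ∀ a b → ι (a ℕ.* b) ≃ ι a Q.* ι b
ι-* a b = *≡* (cong (ℤ._* + 1) (ℤP.pos-* a b))

ι*recip : ∀ d .{{_ : NonZero d}} → ι d Q.* recip d ≃ 1ℚᵘ
ι*recip (suc m) = *≡* (trans (ℤP.*-identityʳ _) (trans (ℤP.*-identityʳ _)
  (sym (trans (ℤP.*-identityˡ _) (cong (λ k → + suc k) (ℕP.+-identityʳ m))))))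

recip-* : ∀ a b .{{_ : NonZero a}} .{{_ : NonZero b}} → recip (a ℕ.* b) ≃ recip a Q.* recip b
recip-* (suc a) (suc b) = *≡* refl

ι-recip-cancel : ∀ d .{{_ : NonZero d}} y → ι d Q.* (recip d Q.* y) ≃ y
ι-recip-cancel d y = begin
  ι d Q.* (recip d Q.* y)   ≈⟨ QP.*-assoc (ι d) (recip d) y ⟨
  ι d Q.* recip d Q.* y     ≈⟨ QP.*-congʳ {y} (ι*recip d) ⟩
  1ℚᵘ Q.* y                 ≈⟨ QP.*-identityˡ y ⟩
  y                         ∎
  where open QP.≃-Reasoning

recip-ι-cancel : ∀ d .{{_ : NonZero d}} y → recip d Q.* (ι d Q.* y) ≃ y
recip-ι-cancel d y = ≃-trans (≃-trans (≃-sym (QP.*-assoc (recip d) (ι d) y))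
  (QP.*-congʳ {y} (QP.*-comm (recip d) (ι d)))) (≃-trans (QP.*-assoc (ι d) (recip d) y) (ι-recip-cancel d y))

x-[x-y]≃y : ∀ x y → x Q.- (x Q.- y) ≃ y
x-[x-y]≃y = solve 2 (λ x y → x :- (x :- y) := y) ≃-refl

toℚᵘ-1/ : ∀ d .{{_ : NonZero d}} → toℚᵘ ((+ 1 ℚ./ d)) ≃ recip d
toℚᵘ-1/ (suc m) = ℚP.toℚᵘ-fromℚᵘ (recip (suc m))

Hᵘ : ℕ → ℕ → ℚᵘ
Hᵘ s zero    = 0ℚᵘ
Hᵘ s (suc n) = Hᵘ s n Q.+ recip (suc n ^ s)

toℚᵘ-H : ∀ s n → toℚᵘ (H s n) ≃ Hᵘ s n
toℚᵘ-H s zero    = ≃-refl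
toℚᵘ-H s (suc n) = ≃-trans (ℚP.toℚᵘ-homo-+ (H s n) (invPow s n))
  (QP.+-cong (toℚᵘ-H s n) (toℚᵘ-1/ (suc n ^ s) {{ℕP.m^n≢0 (suc n) s}}))

module Valuation (p : ℕ) (isPrime : Prime p) where

  instance
    p≢0 : NonZero p
    p≢0 = prime⇒nonZero isPrime

  1<p : 1 < p
  1<p = ℕ.nonTrivial⇒n>1 p {{prime⇒nonTrivial isPrime}}

  p∤1 : ¬ p ∣ 1
  p∤1 p∣1 = ¬prime[1] (subst Prime (ℕD.∣1⇒≡1 p∣1) isPrime)

  p∤* : ∀ {a b} → ¬ p ∣ a → ¬ p ∣ b → ¬ p ∣ a ℕ.* b
  p∤* {a} {b} p∤a p∤b p∣ab with euclidsLemma a b isPrime p∣ab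
  ... | inj₁ p∣a = p∤a p∣a
  ... | inj₂ p∣b = p∤b p∣b

  p∤^ : ∀ {k} t → ¬ p ∣ k → ¬ p ∣ k ^ t
  p∤^ zero    p∤k = p∤1
  p∤^ (suc t) p∤k = p∤* p∤k (p∤^ t p∤k)

  record Val≥ (e : ℕ) (x : ℚᵘ) : Set where
    constructor val≥
    field
      num   : ℤ
      den-1 : ℕ
      p∤den : ¬ p ∣ suc den-1
      x≃    : x ≃ mkℚᵘ (+ (p ^ e) ℤ.* num) den-1

  +p^-+ : ∀ e f → + (p ^ (e ℕ.+ f)) ≡ + (p ^ e) ℤ.* + (p ^ f)
  +p^-+ e f = trans (cong +_ (ℕP.^-distribˡ-+-* p e f)) (ℤP.pos-* (p ^ e) (p ^ f))

  Val≥-resp : ∀ {e x y} → x ≃ y → Val≥ e x → Val≥ e y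
  Val≥-resp x≃y (val≥ a b p∤b x≃) = val≥ a b p∤b (≃-trans (≃-sym x≃y) x≃)

  Val≥-zero : ∀ e → Val≥ e 0ℚᵘ
  Val≥-zero e = val≥ (+ 0) 0 p∤1 (*≡* (cong (ℤ._* + 1) (sym (ℤP.*-zeroʳ (+ (p ^ e))))))

  Val≥-≃0 : ∀ {e x} → x ≃ 0ℚᵘ → Val≥ e x
  Val≥-≃0 {e} x≃0 = Val≥-resp (≃-sym x≃0) (Val≥-zero e)

  Val≥-+ : ∀ {e x y} → Val≥ e x → Val≥ e y → Val≥ e (x Q.+ y)
  Val≥-+ {e} (val≥ a b p∤b x≃) (val≥ c d p∤d y≃) =
    val≥ (a ℤ.* + suc d ℤ.+ c ℤ.* + suc b) _ (p∤* p∤b p∤d)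
      (≃-trans (QP.+-cong x≃ y≃) (*≡* (factor-p^e (+ (p ^ e)) a c (+ suc d) (+ suc b) _)))
    where
    factor-p^e : ∀ P a c D B X →
      (P ℤ.* a ℤ.* D ℤ.+ P ℤ.* c ℤ.* B) ℤ.* X ≡ (P ℤ.* (a ℤ.* D ℤ.+ c ℤ.* B)) ℤ.* X
    factor-p^e = solve-∀

  Val≥-neg : ∀ {e x} → Val≥ e x → Val≥ e (Q.- x)
  Val≥-neg {e} (val≥ a b p∤b x≃) =
    val≥ (ℤ.- a) b p∤b (≃-trans (QP.-‿cong x≃) (*≡* (neg-inside (+ (p ^ e)) a _)))
    where
    neg-inside : ∀ P a X → (ℤ.- (P ℤ.* a)) ℤ.* X ≡ (P ℤ.* (ℤ.- a)) ℤ.* X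
    neg-inside = solve-∀

  Val≥-- : ∀ {e x y} → Val≥ e x → Val≥ e y → Val≥ e (x Q.- y)
  Val≥-- vx vy = Val≥-+ vx (Val≥-neg vy)

  Val≥-* : ∀ {e x y} → Val≥ e x → Val≥ 0 y → Val≥ e (x Q.* y)
  Val≥-* {e} (val≥ a b p∤b x≃) (val≥ c d p∤d y≃) =
    val≥ (a ℤ.* c) _ (p∤* p∤b p∤d) (≃-trans (QP.*-cong x≃ y≃) (*≡* (regroup (+ (p ^ e)) a c _)))
    where
    regroup : ∀ P a c X → (P ℤ.* a ℤ.* (+ 1 ℤ.* c)) ℤ.* X ≡ (P ℤ.* (a ℤ.* c)) ℤ.* X
    regroup = solve-∀

  Val≥-weaken : ∀ {e f x} → e ≤ f → Val≥ f x → Val≥ e x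
  Val≥-weaken {e} {f} e≤f (val≥ a b p∤b x≃) =
    val≥ (+ (p ^ (f ∸ e)) ℤ.* a) b p∤b (≃-trans x≃ (*≡* (cong (ℤ._* + suc b) split)))
    where
    open ≡-Reasoning
    split : + (p ^ f) ℤ.* a ≡ + (p ^ e) ℤ.* (+ (p ^ (f ∸ e)) ℤ.* a)
    split = begin
      + (p ^ f) ℤ.* a                          ≡⟨ cong (λ k → + (p ^ k) ℤ.* a) (sym (ℕP.m+[n∸m]≡n e≤f)) ⟩
      + (p ^ (e ℕ.+ (f ∸ e))) ℤ.* a            ≡⟨ cong (ℤ._* a) (+p^-+ e (f ∸ e)) ⟩
      + (p ^ e) ℤ.* + (p ^ (f ∸ e)) ℤ.* a      ≡⟨ ℤP.*-assoc (+ (p ^ e)) _ a ⟩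
      + (p ^ e) ℤ.* (+ (p ^ (f ∸ e)) ℤ.* a)    ∎

  Val≥-p^* : ∀ e t → Val≥ e (ι (p ^ e ℕ.* t))
  Val≥-p^* e t = val≥ (+ t) 0 p∤1 (*≡* (cong (ℤ._* + 1) (ℤP.pos-* (p ^ e) t)))

  Val≥-multiple : ∀ {e N} t → p ^ e ∣ N → Val≥ e (ι (t ℕ.* N))
  Val≥-multiple {e} t (divides c refl) =
    Val≥-resp (≃-reflexive (cong ι (rearrange t c (p ^ e)))) (Val≥-p^* e (t ℕ.* c))
    where
    rearrange : ∀ t c P → P ℕ.* (t ℕ.* c) ≡ t ℕ.* (c ℕ.* P)
    rearrange = ℕ-Solver.solve-∀

  Val≥-ι : ∀ n → Val≥ 0 (ι n)
  Val≥-ι n = Val≥-resp (≃-reflexive (cong ι (ℕP.*-identityˡ n))) (Val≥-p^* 0 n)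

  Val≥-recip : ∀ {k} → ¬ p ∣ k → Val≥ 0 (recip k)
  Val≥-recip {zero}  p∤0 = ⊥-elim (p∤0 (p ℕD.∣0))
  Val≥-recip {suc d} p∤k = val≥ (+ 1) d p∤k (*≡* refl)

  p^∣-cancel : ∀ e {z b} → ¬ p ∣ b → p ^ e ∣ z ℕ.* b → p ^ e ∣ z
  p^∣-cancel zero    _   _ = ℕD.1∣ _
  p^∣-cancel (suc e) {z} {b} p∤b p^1+e∣zb with euclidsLemma z b isPrime (ℕD.∣-trans (ℕD.m∣m*n (p ^ e)) p^1+e∣zb)
  ... | inj₂ p∣b = ⊥-elim (p∤b p∣b)
  ... | inj₁ (divides t refl) = subst (p ^ suc e ∣_) (ℕP.*-comm p t)
    (ℕD.*-monoʳ-∣ p (p^∣-cancel e p∤b (ℕD.*-cancelˡ-∣ p (subst (p ^ suc e ∣_) (regroup t p b) p^1+e∣zb))))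
    where
    regroup : ∀ t p b → t ℕ.* p ℕ.* b ≡ p ℕ.* (t ℕ.* b)
    regroup = ℕ-Solver.solve-∀

  Val≥-ι⁻¹ : ∀ {e} z → Val≥ e (ι z) → p ^ e ∣ z
  Val≥-ι⁻¹ {e} z (val≥ a b p∤b (*≡* eq)) = p^∣-cancel e p∤b (divides ℤ.∣ a ∣ (begin
    z ℕ.* suc b                               ≡⟨ ℤP.abs-* (+ z) (+ suc b) ⟨
    ℤ.∣ + z ℤ.* + suc b ∣                     ≡⟨ cong ℤ.∣_∣ eq ⟩
    ℤ.∣ + (p ^ e) ℤ.* a ℤ.* + 1 ∣             ≡⟨ cong ℤ.∣_∣ (ℤP.*-identityʳ (+ (p ^ e) ℤ.* a)) ⟩
    ℤ.∣ + (p ^ e) ℤ.* a ∣                     ≡⟨ ℤP.abs-* (+ (p ^ e)) a ⟩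
    p ^ e ℕ.* ℤ.∣ a ∣                         ≡⟨ ℕP.*-comm (p ^ e) ℤ.∣ a ∣ ⟩
    ℤ.∣ a ∣ ℕ.* p ^ e                         ∎))
    where open ≡-Reasoning

  Val≥-ι-difference : ∀ {e x h} → Val≥ e x → Val≥ e (x Q.- ι h) → p ^ e ∣ h
  Val≥-ι-difference {x = x} {h} vx vd = Val≥-ι⁻¹ h (Val≥-resp (x-[x-y]≃y x (ι h)) (Val≥-- vx vd))

  p^-+-split : ∀ f e a b → mkℚᵘ (+ (p ^ (f ℕ.+ e)) ℤ.* a) b ≃ ι (p ^ f) Q.* mkℚᵘ (+ (p ^ e) ℤ.* a) b
  p^-+-split f e a b = *≡* (begin
    + (p ^ (f ℕ.+ e)) ℤ.* a ℤ.* + suc (b ℕ.+ 0)              ≡⟨ cong₂ (λ P k → P ℤ.* a ℤ.* + suc k) (+p^-+ f e) (ℕP.+-identityʳ b) ⟩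
    + (p ^ f) ℤ.* + (p ^ e) ℤ.* a ℤ.* + suc b               ≡⟨ cong (ℤ._* + suc b) (ℤP.*-assoc (+ (p ^ f)) (+ (p ^ e)) a) ⟩
    + (p ^ f) ℤ.* (+ (p ^ e) ℤ.* a) ℤ.* + suc b             ∎)
    where open ≡-Reasoning

  Val≥-p^-shift : ∀ {e x} f → Val≥ e x → Val≥ (f ℕ.+ e) (ι (p ^ f) Q.* x)
  Val≥-p^-shift {e} f (val≥ a b p∤b x≃) =
    val≥ a b p∤b (≃-trans (QP.*-congˡ {ι (p ^ f)} x≃) (≃-sym (p^-+-split f e a b)))

  Val≥-recip-p^-shift : ∀ {e x} f → Val≥ (f ℕ.+ e) x → Val≥ e (recip (p ^ f) Q.* x)
  Val≥-recip-p^-shift {e} {x} f (val≥ a b p∤b x≃) = val≥ a b p∤b (begin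
    recip (p ^ f) Q.* x                      ≈⟨ QP.*-congˡ {recip (p ^ f)} (≃-trans x≃ (p^-+-split f e a b)) ⟩
    recip (p ^ f) Q.* (ι (p ^ f) Q.* y)      ≈⟨ recip-ι-cancel (p ^ f) {{ℕP.m^n≢0 p f}} y ⟩
    y                                        ∎)
    where
    open QP.≃-Reasoning
    y = mkℚᵘ (+ (p ^ e) ℤ.* a) b

  p∤reduced-den : ∀ {m d} .(c : Coprime m (suc d)) t → m ≡ t ℕ.* p → ¬ p ∣ suc d
  p∤reduced-den c t m≡tp p∣d = ¬prime[1] (subst Prime (Coprimality.recompute c (divides t m≡tp , p∣d)) isPrime)

  +m≡p*t : ∀ m t → m ≡ t ℕ.* p → + m ≡ + (p ^ 1) ℤ.* + t
  +m≡p*t m t m≡tp = trans (cong +_ (trans m≡tp (trans (ℕP.*-comm t p) (cong (ℕ._* t) (sym (ℕP.*-identityʳ p))))))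
    (ℤP.pos-* (p ^ 1) t)

  zeroModP⇒Val≥1 : ∀ x → ZeroModP p x → Val≥ 1 (toℚᵘ x)
  zeroModP⇒Val≥1 x (inj₁ refl) = Val≥-zero 1
  zeroModP⇒Val≥1 (mkℚ (+ m) d c) (inj₂ (divides t m≡tp)) =
    val≥ (+ t) d (p∤reduced-den c t m≡tp) (*≡* (cong (ℤ._* + suc d) (+m≡p*t m t m≡tp)))
  zeroModP⇒Val≥1 (mkℚ -[1+ m ] d c) (inj₂ (divides t m≡tp)) =
    val≥ (ℤ.- + t) d (p∤reduced-den c t m≡tp) (*≡* (cong (ℤ._* + suc d) (begin
      ℤ.- + suc m                    ≡⟨ cong ℤ.-_ (+m≡p*t (suc m) t m≡tp) ⟩
      ℤ.- (+ (p ^ 1) ℤ.* + t)        ≡⟨ ℤP.neg-distribʳ-* (+ (p ^ 1)) (+ t) ⟩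
      + (p ^ 1) ℤ.* ℤ.- + t          ∎)))
    where open ≡-Reasoning

^-distrib-* : ∀ a b t → (a ℕ.* b) ^ t ≡ a ^ t ℕ.* b ^ t
^-distrib-* a b zero    = refl
^-distrib-* a b (suc t) = trans (cong (a ℕ.* b ℕ.*_) (^-distrib-* a b t)) (interchange a b (a ^ t) (b ^ t))
  where
  interchange : ∀ a b x y → a ℕ.* b ℕ.* (x ℕ.* y) ≡ a ℕ.* x ℕ.* (b ℕ.* y)
  interchange = ℕ-Solver.solve-∀

digits : ∀ n p .{{_ : NonZero p}} → n ≡ n / p ℕ.* p ℕ.+ n % p
digits n p = trans (m≡m%n+[m/n]*n n p) (ℕP.+-comm (n % p) _)

module Descent (p : ℕ) (isPrime : Prime p) (s : ℕ) where
  open Valuation p isPrime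

  p⁻ˢ : ℚᵘ
  p⁻ˢ = recip (p ^ s)

  -- X q r = H(s; qp + r) − p^{-s} H(s; q): the terms with index divisible by p
  -- are exactly p^{-s} times the terms of H(s; q), so X only sums p-adic units.
  X : ℕ → ℕ → ℚᵘ
  X q r = Hᵘ s (q ℕ.* p ℕ.+ r) Q.- p⁻ˢ Q.* Hᵘ s q

  X-step : ∀ q r → X q (suc r) ≃ X q r Q.+ recip (suc (q ℕ.* p ℕ.+ r) ^ s)
  X-step q r = ≃-trans (QP.+-congˡ (Q.- (p⁻ˢ Q.* Hᵘ s q)) (≃-reflexive (cong (Hᵘ s) (ℕP.+-suc (q ℕ.* p) r))))
    (move-term (Hᵘ s (q ℕ.* p ℕ.+ r)) (p⁻ˢ Q.* Hᵘ s q) _)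
    where
    move-term : ∀ A B T → (A Q.+ T) Q.- B ≃ (A Q.- B) Q.+ T
    move-term = solve 3 (λ A B T → (A :+ T) :- B := (A :- B) :+ T) ≃-refl

  -- Passing to the next multiple of p adds the same term p^{-s}(q+1)^{-s} to both parts.
  X-carry : ∀ q → X (suc q) 0 ≃ X q (p ∸ 1)
  X-carry q = begin
    X (suc q) 0                                                       ≈⟨ QP.+-congˡ (Q.- (p⁻ˢ Q.* Hᵘ s (suc q))) (≃-reflexive (cong (Hᵘ s) index)) ⟩
    Hᵘ s n Q.+ recip (suc n ^ s) Q.- p⁻ˢ Q.* Hᵘ s (suc q)             ≈⟨ QP.+-congˡ (Q.- (p⁻ˢ Q.* Hᵘ s (suc q))) (QP.+-congʳ (Hᵘ s n) last-term) ⟩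
    Hᵘ s n Q.+ p⁻ˢ Q.* recip (suc q ^ s) Q.- p⁻ˢ Q.* Hᵘ s (suc q)    ≈⟨ cancel (Hᵘ s n) p⁻ˢ (Hᵘ s q) (recip (suc q ^ s)) ⟩
    X q (p ∸ 1)                                                       ∎
    where
    open QP.≃-Reasoning
    n = q ℕ.* p ℕ.+ (p ∸ 1)
    index : suc q ℕ.* p ℕ.+ 0 ≡ suc n
    index = trans (ℕP.+-identityʳ _) (trans (ℕP.+-comm p (q ℕ.* p))
      (trans (cong (q ℕ.* p ℕ.+_) (sym (ℕP.suc-pred p))) (ℕP.+-suc (q ℕ.* p) (p ∸ 1))))
    last-term : recip (suc n ^ s) ≃ p⁻ˢ Q.* recip (suc q ^ s)
    last-term = ≃-trans (≃-reflexive (cong (λ k → recip (k ^ s)) (trans (sym index)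
        (trans (ℕP.+-identityʳ _) (ℕP.*-comm (suc q) p)))))
      (≃-trans (≃-reflexive (cong recip (^-distrib-* p (suc q) s)))
        (recip-* (p ^ s) (suc q ^ s) {{ℕP.m^n≢0 p s}} {{ℕP.m^n≢0 (suc q) s}}))
    cancel : ∀ A P Hq T → (A Q.+ P Q.* T) Q.- P Q.* (Hq Q.+ T) ≃ A Q.- P Q.* Hq
    cancel = solve 4 (λ A P Hq T → (A :+ P :* T) :- P :* (Hq :+ T) := A :- P :* Hq) ≃-refl

  p∸1<p : p ∸ 1 < p
  p∸1<p = pred<self p
    where
    pred<self : ∀ n .{{_ : NonZero n}} → n ∸ 1 < n
    pred<self (suc n) = ℕP.n<1+n n

  p∤digit : ∀ q r → suc r < p → ¬ p ∣ suc (q ℕ.* p ℕ.+ r)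
  p∤digit q r r<p p∣ = ℕP.<⇒≱ r<p (ℕD.∣⇒≤ (ℕD.∣m+n∣m⇒∣n
    (subst (p ∣_) (sym (ℕP.+-suc (q ℕ.* p) r)) p∣) (ℕD.n∣m*n q)))

  X-integral : ∀ q r → r < p → Val≥ 0 (X q r)
  X-integral zero    zero    _   = Val≥-≃0 (QP.+-congʳ 0ℚᵘ (QP.-‿cong (QP.*-zeroʳ p⁻ˢ)))
  X-integral (suc q) zero    _   = Val≥-resp (≃-sym (X-carry q)) (X-integral q (p ∸ 1) p∸1<p)
  X-integral q       (suc r) r<p = Val≥-resp (≃-sym (X-step q r))
    (Val≥-+ (X-integral q r (ℕP.<-trans (ℕP.n<1+n r) r<p)) (Val≥-recip (p∤^ s (p∤digit q r r<p))))

  H-decomposition : ∀ n → Val≥ 0 (Hᵘ s n Q.- p⁻ˢ Q.* Hᵘ s (n / p))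
  H-decomposition n = Val≥-resp (QP.+-congˡ (Q.- (p⁻ˢ Q.* Hᵘ s (n / p))) (≃-reflexive (cong (Hᵘ s) (sym (digits n p)))))
    (X-integral (n / p) (n % p) (m%n<n n p))

  descent : ∀ n → Val≥ 1 (Hᵘ s n) → Val≥ s (Hᵘ s (n / p))
  descent n v = subst (λ e → Val≥ e (Hᵘ s (n / p))) (ℕP.+-identityʳ s)
    (Val≥-resp (ι-recip-cancel (p ^ s) {{ℕP.m^n≢0 p s}} (Hᵘ s (n / p)))
      (Val≥-p^-shift s (Val≥-resp (x-[x-y]≃y (Hᵘ s n) _) (Val≥-- (Val≥-weaken z≤n v) (H-decomposition n)))))

module Pruning (p : ℕ) .{{_ : NonZero p}} (1<p : 1 < p) (Bad Exceptional : ℕ → Set)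
  (descend : ∀ m → Bad m → Bad (m / p))
  (roots : ∀ m → 1 ≤ m → m < p → Bad m → Exceptional m)
  (leaves : ∀ m → Exceptional m → ∀ r → r < p → ¬ Bad (m ℕ.* p ℕ.+ r)) where

  bad⇒one-digit : ∀ m → 1 ≤ m → Bad m → m < p
  bad⇒one-digit = <-rec (λ m → 1 ≤ m → Bad m → m < p) step
    where
    step : ∀ m → (∀ {k} → k < m → 1 ≤ k → Bad k → k < p) → 1 ≤ m → Bad m → m < p
    step m rec 1≤m bad with m ℕP.<? p
    ... | yes m<p = m<p
    ... | no  m≮p = ⊥-elim (leaves q (roots q 1≤q q<p bad-q) (m % p) (m%n<n m p) (subst Bad (digits m p) bad))
      where
      q = m / p
      1≤q : 1 ≤ q
      1≤q = m≥n⇒m/n>0 (ℕP.≮⇒≥ m≮p)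
      bad-q : Bad q
      bad-q = descend m bad
      q<p : q < p
      q<p = rec (m/n<m m p {{ℕ.>-nonZero 1≤m}} 1<p) 1≤q bad-q

  bad-parent⇒n<p² : ∀ n → Bad (n / p) → n < p ℕ.* p
  bad-parent⇒n<p² n bad with n ℕP.<? p
  ... | yes n<p = ℕP.<-≤-trans n<p (ℕP.m≤m*n p p)
  ... | no  n≮p = begin-strict
    n                          ≡⟨ digits n p ⟩
    n / p ℕ.* p ℕ.+ n % p      <⟨ ℕP.+-monoʳ-< (n / p ℕ.* p) (m%n<n n p) ⟩
    n / p ℕ.* p ℕ.+ p          ≡⟨ ℕP.+-comm (n / p ℕ.* p) p ⟩
    suc (n / p) ℕ.* p          ≤⟨ ℕP.*-monoˡ-≤ p (bad⇒one-digit (n / p) (m≥n⇒m/n>0 (ℕP.≮⇒≥ n≮p)) bad) ⟩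
    p ℕ.* p                    ∎
    where open ℕP.≤-Reasoning

-- All arithmetic is on ℕ modulo N = suc N'
-- (writing the modulus as a successor avoids NonZero side conditions).  Soundness
-- does not depend on these programs being correct: the lemmas after this module
-- derive the mathematical facts from their Boolean results, and every inverse
-- they use is re-verified.
module Kernel where
  open import Data.Nat.Base
  open import Data.Bool.Base using (Bool; true; false; _∧_; _∨_; not)
  open import Data.List.Base using (List; []; _∷_; map; replicate)
  open import Data.Product.Base using (_×_; _,_)
  open import Data.Maybe.Base using (Maybe; just; nothing)

  -- acc · b^e mod N by binary exponentiation, stopping after `fuel` squarings
  powMod : (fuel N' b e acc : ℕ) → ℕ
  powMod-bit : (bit fuel N' b e acc : ℕ) → ℕ
  powMod zero     N' b e         acc = acc
  powMod (suc f) N' b zero      acc = acc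
  powMod (suc f) N' b e@(suc _) acc = powMod-bit (e % 2) f N' b e acc
  powMod-bit zero    f N' b e acc = powMod f N' ((b * b) % suc N') (e / 2) acc
  powMod-bit (suc _) f N' b e acc = powMod f N' ((b * b) % suc N') (e / 2) ((acc * b) % suc N')

  -- Batch inversion of k0+1, …, k0+c modulo N: one exponentiation x^(φ(N)-1)
  -- of the product x, then the individual inverses by unwinding prefix products.
  prefixProducts : (N' k0 j c acc : ℕ) → List ℕ → ℕ × List ℕ
  prefixProducts N' k0 j zero    acc rev = acc , rev
  prefixProducts N' k0 j (suc c) acc rev =
    prefixProducts N' k0 (suc j) c ((acc * (k0 + suc j)) % suc N') (acc ∷ rev)

  unwindInverses : (N' k0 j I : ℕ) → List ℕ → List ℕ → List ℕ
  unwindInverses N' k0 j I []        out = out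
  unwindInverses N' k0 j I (x ∷ rev) out =
    unwindInverses N' k0 (pred j) ((I * (k0 + j)) % suc N') rev (((x * I) % suc N') ∷ out)

  batchInverses′ : (N' φ-1 k0 c : ℕ) → ℕ × List ℕ → List ℕ
  batchInverses′ N' φ-1 k0 c (P , rev) = unwindInverses N' k0 c (powMod 20000 N' P φ-1 1) rev []

  batchInverses : (N' φ-1 k0 c : ℕ) → List ℕ
  batchInverses N' φ-1 k0 c = batchInverses′ N' φ-1 k0 c (prefixProducts N' k0 0 c 1 [])

  -- Given i ≡ 1/k and q ≡ 1/k^t, add 1/k^(t+1), 1/k^(t+2), … to the successive entries.
  addPowers : (N' i q : ℕ) → List ℕ → List ℕ
  addPowers′ : (N' i q′ h : ℕ) → List ℕ → List ℕ
  addPowers N' i q []       = []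
  addPowers N' i q (h ∷ hs) = addPowers′ N' i ((q * i) % suc N') h hs
  addPowers′ N' i q′ h hs = ((h + q′) % suc N') ∷ addPowers N' i q′ hs

  productMod : (N' acc : ℕ) → List ℕ → ℕ
  productMod N' acc []       = acc
  productMod N' acc (h ∷ hs) = productMod N' ((acc * h) % suc N') hs

  dividesᵇ : ℕ → ℕ → Bool
  dividesᵇ zero    h = h ≡ᵇ 0
  dividesᵇ (suc d) h = (h % suc d) ≡ᵇ 0

  -- The two pairs (p, s) with a one-digit index k where p^s ∣ H(s;k):
  -- p^2 ∣ H(2;3) = 49/36 for p = 7, and p^3 ∣ H(3;36) for p = 37.
  exceptional : (p s k : ℕ) → Bool
  exceptional p s k = ((p ≡ᵇ 7) ∧ (s ≡ᵇ 2) ∧ (k ≡ᵇ 3)) ∨ ((p ≡ᵇ 37) ∧ (s ≡ᵇ 3) ∧ (k ≡ᵇ 36))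

  -- The table hs holds H(s;k) mod N for s = s₀, s₀+1, ….  For a prime power p^E ∣ N
  -- an entry certifies v_p(H(s;k)) < s as soon as p^min(s,E) does not divide it.
  -- lowOK tests the entries with s < E; if the product of all entries is prime to
  -- p^E, no entry is divisible by p^E and the entries with s ≥ E need no test.
  lowOK : (p E k s : ℕ) → List ℕ → Bool
  lowOK′ : Bool → (p E k s h : ℕ) → List ℕ → Bool
  lowOK p E k s []       = true
  lowOK p E k s (h ∷ hs) = lowOK′ (s <ᵇ E) p E k s h hs
  lowOK′ false p E k s h hs = true
  lowOK′ true  p E k s h hs = (exceptional p s k ∨ not (dividesᵇ (p ^ s) h)) ∧ lowOK p E k (suc s) hs

  fullOK : (p E k s : ℕ) → List ℕ → Bool
  fullOK p E k s []       = true
  fullOK p E k s (h ∷ hs) = (exceptional p s k ∨ not (dividesᵇ (p ^ (s ⊓ E)) h)) ∧ fullOK p E k (suc s) hs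

  primeOK : (p E k : ℕ) → List ℕ → ℕ → Bool
  primeOK p E k hs π = lowOK p E k 2 hs ∧ (not (dividesᵇ (p ^ E) π) ∨ fullOK p E k 2 hs)

  allPrimesOK : List (ℕ × ℕ) → ℕ → List ℕ → ℕ → Bool
  allPrimesOK []             k hs π = true
  allPrimesOK ((p , E) ∷ ps) k hs π = primeOK p E k hs π ∧ allPrimesOK ps k hs π

  -- A batch is a list of pairs (p, E), in increasing order of p.
  modulus : List (ℕ × ℕ) → ℕ
  modulus []             = 1
  modulus ((p , E) ∷ ps) = p ^ E * modulus ps

  totient : List (ℕ × ℕ) → ℕ
  totient []             = 1
  totient ((p , E) ∷ ps) = p ^ pred E * pred p * totient ps

  smallestPrime : List (ℕ × ℕ) → ℕ
  smallestPrime []            = 0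
  smallestPrime ((p , E) ∷ _) = p

  -- scan ps N' invs c k hs: the table hs is at index k, the candidate inverses of
  -- k+1, …, k+c are invs; step k up to k+c, checking every prime of the batch at
  -- each index, then drop the smallest prime (whose range 1 ≤ k < p is done).
  scan : (ps : List (ℕ × ℕ)) (N' : ℕ) (invs : List ℕ) (c k : ℕ) (hs : List ℕ) → Bool
  scan-inverse : Bool → (ps : List (ℕ × ℕ)) (N' : ℕ) (invs : List ℕ) (c k i : ℕ) (hs : List ℕ) → Bool
  scan-check : (ps : List (ℕ × ℕ)) (N' : ℕ) (invs : List ℕ) (c k : ℕ) (hs : List ℕ) → Bool
  restart : (ps : List (ℕ × ℕ)) (k : ℕ) (hs : List ℕ) → Bool
  restart′ : (ps : List (ℕ × ℕ)) (k : ℕ) (hs : List ℕ) → ℕ → Bool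
  scan []       N' invs       c       k hs = true
  scan (x ∷ ps) N' invs       zero    k hs = restart ps k hs
  scan (x ∷ ps) N' []         (suc c) k hs = false
  scan (x ∷ ps) N' (i ∷ invs) (suc c) k hs =
    scan-inverse ((suc k * i) % suc N' ≡ᵇ 1) (x ∷ ps) N' invs c (suc k) i hs
  scan-inverse false ps N' invs c k i hs = false
  scan-inverse true  ps N' invs c k i hs = scan-check ps N' invs c k (addPowers N' i i hs)
  scan-check ps N' invs c k hs = allPrimesOK ps k hs (productMod N' 1 hs) ∧ scan ps N' invs c k hs
  restart ps k hs = restart′ ps k hs (modulus ps)
  restart′ ps k hs zero       = false
  restart′ ps k hs (suc N')   =
    scan ps N' (batchInverses N' (pred (totient ps)) k (smallestPrime ps ∸ 1 ∸ k))
      (smallestPrime ps ∸ 1 ∸ k) k (map (λ h → h % suc N') hs)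

  -- Check a batch for s = 2, …, 300, starting from H(s;0) = 0.
  checkBatch : List (ℕ × ℕ) → Bool
  checkBatch ps = restart ps 0 (replicate 299 0)

  -- Direct evaluation of X q r = H(s; qp+r) − p^{-s} H(s; q) modulo N (see Descent),
  -- following the recursion of X-integral; nothing means an inverse check failed.
  powModNaive : (N' i t : ℕ) → ℕ
  powModNaive N' i zero    = 1
  powModNaive N' i (suc t) = (powModNaive N' i t * i) % suc N'

  addInversePower′ : Bool → (N' s h i : ℕ) → Maybe ℕ
  addInversePower′ false N' s h i = nothing
  addInversePower′ true  N' s h i = just ((h + powModNaive N' i s) % suc N')

  -- add 1/k^s, with 1/k computed as k^(φ(N)-1) and then verified
  addInversePower : (N' φ-1 s k : ℕ) → Maybe ℕ → Maybe ℕ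
  addInversePower N' φ-1 s k nothing  = nothing
  addInversePower N' φ-1 s k (just h) = withInverse (powMod 200 N' k φ-1 1)
    where
    withInverse : ℕ → Maybe ℕ
    withInverse i = addInversePower′ ((k * i) % suc N' ≡ᵇ 1) N' s h i

  evalX : (p N' φ-1 s q r : ℕ) → Maybe ℕ
  evalX p N' φ-1 s q       (suc r) = addInversePower N' φ-1 s (suc (q * p + r)) (evalX p N' φ-1 s q r)
  evalX p N' φ-1 s zero    zero    = just 0
  evalX p N' φ-1 s (suc q) zero    = evalX p N' φ-1 s q (p ∸ 1)

  allBelow : ℕ → (ℕ → Bool) → Bool
  allBelow zero    f = true
  allBelow (suc n) f = f n ∧ allBelow n f

  -- For an exceptional one-digit m: with H(s;m) ≡ p^s·c′ (mod p^(s+2)), every child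
  -- mp + r has H(s; mp+r) ≡ X m r + c′ (mod p²), which must be nonzero mod p².
  childOK : (p s c′ : ℕ) → Maybe ℕ → Bool
  childOK p s c′ nothing  = false
  childOK p s c′ (just a) = not (dividesᵇ (p ^ 2) (a + c′))

  childrenOK′ : (p s m c : ℕ) → Bool
  childrenOK′ p s m c = (c ≡ᵇ p ^ s * (c / suc (pred (p ^ s)))) ∧
    allBelow p (λ r → childOK p s (c / suc (pred (p ^ s))) (evalX p (pred (p ^ 2)) (pred (p * pred p)) s m r))

  childrenOK″ : (p s m : ℕ) → Maybe ℕ → Bool
  childrenOK″ p s m nothing  = false
  childrenOK″ p s m (just c) = childrenOK′ p s m c

  childrenOK : (p s m : ℕ) → Bool
  childrenOK p s m = childrenOK″ p s m (evalX p (pred (p ^ (s + 2))) (pred (p ^ (s + 1) * pred p)) s 0 m)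

open Kernel

dividesᵇ-false : ∀ d h → T (not (dividesᵇ d h)) → ¬ d ∣ h
dividesᵇ-false zero    h nd 0∣h = subst (λ x → T (not (x ℕ.≡ᵇ 0))) (ℕD.0∣⇒≡0 0∣h) nd
dividesᵇ-false (suc d) h nd d∣h = subst (λ x → T (not (x ℕ.≡ᵇ 0))) (ℕD.n∣m⇒m%n≡0 h (suc d) d∣h) nd

dividesᵇ-true : ∀ d h → T (dividesᵇ d h) → d ∣ h
dividesᵇ-true zero    h ok = subst (0 ∣_) (sym (ℕP.≡ᵇ⇒≡ h 0 ok)) (0 ℕD.∣0)
dividesᵇ-true (suc d) h ok = ℕD.m%n≡0⇒n∣m h (suc d) (ℕP.≡ᵇ⇒≡ _ 0 ok)

-- The expensive checks are proved as equations b ≡ true and then converted.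
-- (b is explicit: T is not injective, so inferring b from the goal would force
-- the evaluation of the check.)
from-≡true : ∀ b → b ≡ true → T b
from-≡true b = Equivalence.from BoolP.T-≡

split-∧ : ∀ {a b} → T (a ∧ b) → T a × T b
split-∧ = Equivalence.to BoolP.T-∧

split-∨ : ∀ {a b} → T (a ∨ b) → T a ⊎ T b
split-∨ = Equivalence.to BoolP.T-∨

allBelow-sound : ∀ n f → T (allBelow n f) → ∀ r → r < n → T (f r)
allBelow-sound (suc n) f ok r r<1+n with ℕP.m≤n⇒m<n∨m≡n (ℕP.≤-pred r<1+n)
... | inj₁ r<n  = allBelow-sound n f (proj₂ (split-∧ ok)) r r<n
... | inj₂ refl = proj₁ (split-∧ ok)

module Congruence (p : ℕ) (isPrime : Prime p) (E : ℕ) (1≤E : 1 ≤ E) where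
  open Valuation p isPrime

  p∣p^E : p ∣ p ^ E
  p∣p^E = subst (λ e → p ∣ p ^ e) (ℕP.m+[n∸m]≡n 1≤E) (ℕD.m∣m*n (p ^ (E ∸ 1)))

  -- x ≡ h (mod p^E): v_p(x − h) ≥ E.  (A record, so that x and h are inferable.)
  infix 4 _≡ₘ_
  record _≡ₘ_ (x : ℚᵘ) (h : ℕ) : Set where
    constructor congruent
    field difference : Val≥ E (x Q.- ι h)
  open _≡ₘ_ public

  ≡ₘ-resp : ∀ {x y h} → x ≃ y → x ≡ₘ h → y ≡ₘ h
  ≡ₘ-resp {h = h} x≃y (congruent d) = congruent (Val≥-resp (QP.+-congˡ (Q.- ι h) x≃y) d)

  ≡ₘ-refl : ∀ {x h} → x ≃ ι h → x ≡ₘ h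
  ≡ₘ-refl {h = h} x≃h = congruent (Val≥-≃0 (≃-trans (QP.+-congˡ (Q.- ι h) x≃h) (QP.+-inverseʳ (ι h))))

  ≡ₘ-trans : ∀ {x h h′} → x ≡ₘ h → ι h ≡ₘ h′ → x ≡ₘ h′
  ≡ₘ-trans {x} {h} {h′} (congruent d) (congruent d′) = congruent (Val≥-resp (telescope x (ι h) (ι h′)) (Val≥-+ d d′))
    where
    telescope : ∀ A B C → (A Q.- B) Q.+ (B Q.- C) ≃ A Q.- C
    telescope = solve 3 (λ A B C → (A :- B) :+ (B :- C) := A :- C) ≃-refl

  ≡ₘ-+ : ∀ {x y h h′} → x ≡ₘ h → y ≡ₘ h′ → x Q.+ y ≡ₘ h ℕ.+ h′
  ≡ₘ-+ {x} {y} {h} {h′} (congruent d) (congruent d′) = congruent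
    (Val≥-resp (≃-sym (≃-trans (QP.+-congʳ (x Q.+ y) (QP.-‿cong (ι-+ h h′))) (regroup x y (ι h) (ι h′))))
      (Val≥-+ d d′))
    where
    regroup : ∀ x y H H′ → (x Q.+ y) Q.- (H Q.+ H′) ≃ (x Q.- H) Q.+ (y Q.- H′)
    regroup = solve 4 (λ x y H H′ → (x :+ y) :- (H :+ H′) := (x :- H) :+ (y :- H′)) ≃-refl

  ≡ₘ-* : ∀ {x y h h′} → Val≥ 0 y → x ≡ₘ h → y ≡ₘ h′ → x Q.* y ≡ₘ h ℕ.* h′
  ≡ₘ-* {x} {y} {h} {h′} y-integral (congruent d) (congruent d′) = congruent
    (Val≥-resp (≃-sym (≃-trans (QP.+-congʳ (x Q.* y) (QP.-‿cong (ι-* h h′))) (regroup x y (ι h) (ι h′))))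
      (Val≥-+ (Val≥-* d y-integral) (Val≥-* d′ (Val≥-ι h))))
    where
    regroup : ∀ x y H H′ → x Q.* y Q.- H Q.* H′ ≃ (x Q.- H) Q.* y Q.+ (y Q.- H′) Q.* H
    regroup = solve 4 (λ x y H H′ → x :* y :- H :* H′ := (x :- H) :* y :+ (y :- H′) :* H) ≃-refl

  Table : ℕ → ℕ → List ℕ → Set
  Table k s []       = ⊤
  Table k s (h ∷ hs) = Hᵘ s k ≡ₘ h × Table k (suc s) hs

  Table-zero : ∀ n s → Table 0 s (replicate n 0)
  Table-zero zero    s = tt
  Table-zero (suc n) s = ≡ₘ-refl ≃-refl , Table-zero n (suc s)

  exceptional-or-p^∤ : ∀ {s k e h} → T (exceptional p s k ∨ not (dividesᵇ (p ^ e) h)) →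
                       T (exceptional p s k) ⊎ ¬ p ^ e ∣ h
  exceptional-or-p^∤ ok with split-∨ ok
  ... | inj₁ exc = inj₁ exc
  ... | inj₂ nd  = inj₂ (dividesᵇ-false _ _ nd)

  Certified : ℕ → ℕ → ℕ → Set
  Certified k s h = T (exceptional p s k) ⊎ ¬ p ^ (s ⊓ E) ∣ h

  AllCertified : ℕ → ℕ → List ℕ → Set
  AllCertified k s []       = ⊤
  AllCertified k s (h ∷ hs) = Certified k s h × AllCertified k (suc s) hs

  certified⇒exceptional : ∀ {k s h} → Hᵘ s k ≡ₘ h → Certified k s h → Val≥ s (Hᵘ s k) → T (exceptional p s k)
  certified⇒exceptional _               (inj₁ exc) _   = exc
  certified⇒exceptional {k} {s} {h} (congruent d) (inj₂ p∤h) bad =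
    ⊥-elim (p∤h (Val≥-ι-difference (Val≥-weaken (ℕP.m⊓n≤m s E) bad) (Val≥-weaken (ℕP.m⊓n≤n s E) d)))

  Checked : ℕ → Set
  Checked m = ∀ s → 2 ≤ s → s ≤ 300 → Val≥ s (Hᵘ s m) → T (exceptional p s m)

  table⇒checked : ∀ k hs → Table k 2 hs → AllCertified k 2 hs → length hs ≡ 299 → Checked k
  table⇒checked k hs tbl cert len s 2≤s s≤300 =
    subst Claim (ℕP.m+[n∸m]≡n 2≤s) (entry 2 hs tbl cert (s ∸ 2) j<len)
    where
    Claim : ℕ → Set
    Claim s = Val≥ s (Hᵘ s k) → T (exceptional p s k)
    j<len : s ∸ 2 < length hs
    j<len = subst (s ∸ 2 <_) (sym len) (ℕP.∸-monoˡ-< {s} {2} {301} (s≤s s≤300) 2≤s)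
    entry : ∀ s hs → Table k s hs → AllCertified k s hs → ∀ j → j < length hs → Claim (s ℕ.+ j)
    entry s (h ∷ hs) (h≡ , _)   (c , _)    zero    _ =
      subst Claim (sym (ℕP.+-identityʳ s)) (certified⇒exceptional {k} h≡ c)
    entry s (h ∷ hs) (_ , tbl) (_ , cert) (suc j) (s≤s j<len) =
      subst Claim (sym (ℕP.+-suc s j)) (entry (suc s) hs tbl cert j j<len)

  LowCertified : ℕ → ℕ → List ℕ → Set
  LowCertified k s []       = ⊤
  LowCertified k s (h ∷ hs) = (s < E → T (exceptional p s k) ⊎ ¬ p ^ s ∣ h) × LowCertified k (suc s) hs

  lowCertified-beyond-E : ∀ k s hs → E ≤ s → LowCertified k s hs
  lowCertified-beyond-E k s []       E≤s = tt
  lowCertified-beyond-E k s (h ∷ hs) E≤s =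
    (λ s<E → ⊥-elim (ℕP.<⇒≱ s<E E≤s)) , lowCertified-beyond-E k (suc s) hs (ℕP.m≤n⇒m≤1+n E≤s)

  lowOK-sound : ∀ k s hs → T (lowOK p E k s hs) → LowCertified k s hs
  lowOK-sound k s []       _  = tt
  lowOK-sound k s (h ∷ hs) ok with s ℕ.<ᵇ E in s<ᵇE
  ... | false = lowCertified-beyond-E k s (h ∷ hs) (ℕP.≮⇒≥ (λ s<E → subst T s<ᵇE (ℕP.<⇒<ᵇ s<E)))
  ... | true  = (λ _ → exceptional-or-p^∤ {s} {k} {s} (proj₁ (split-∧ ok))) , lowOK-sound k (suc s) hs (proj₂ (split-∧ ok))

  low+indivisible⇒certified : ∀ k s hs → LowCertified k s hs → All (λ h → ¬ p ^ E ∣ h) hs → AllCertified k s hs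
  low+indivisible⇒certified k s []       _           _             = tt
  low+indivisible⇒certified k s (h ∷ hs) (low , lows) (p^E∤h ∷ rest) = entry , low+indivisible⇒certified k (suc s) hs lows rest
    where
    entry : Certified k s h
    entry with s ℕP.<? E
    ... | yes s<E = map₂ (subst (λ e → ¬ p ^ e ∣ h) (sym (ℕP.m≤n⇒m⊓n≡m (ℕP.<⇒≤ s<E)))) (low s<E)
    ... | no  s≮E = inj₂ (subst (λ e → ¬ p ^ e ∣ h) (sym (ℕP.m≥n⇒m⊓n≡n (ℕP.≮⇒≥ s≮E))) p^E∤h)

  fullOK-sound : ∀ k s hs → T (fullOK p E k s hs) → AllCertified k s hs
  fullOK-sound k s []       _  = tt
  fullOK-sound k s (h ∷ hs) ok = exceptional-or-p^∤ {s} {k} {s ⊓ E} (proj₁ (split-∧ ok)) , fullOK-sound k (suc s) hs (proj₂ (split-∧ ok))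

  module Modulo (N' : ℕ) (p^E∣N : p ^ E ∣ suc N') where

    ι-≡ₘ-% : ∀ x → ι x ≡ₘ x % suc N'
    ι-≡ₘ-% x = congruent (Val≥-resp (≃-sym (begin
      ι x Q.- ι r                 ≈⟨ QP.+-congˡ (Q.- ι r) (≃-trans (≃-reflexive (cong ι (m≡m%n+[m/n]*n x (suc N')))) (ι-+ r _)) ⟩
      ι r Q.+ ι (x / suc N' ℕ.* suc N') Q.- ι r   ≈⟨ cancel (ι r) _ ⟩
      ι (x / suc N' ℕ.* suc N')   ∎)) (Val≥-multiple (x / suc N') p^E∣N))
      where
      open QP.≃-Reasoning
      r = x % suc N'
      cancel : ∀ A B → (A Q.+ B) Q.- A ≃ B
      cancel = solve 2 (λ A B → (A :+ B) :- A := B) ≃-refl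

    ≡ₘ-% : ∀ {x h} → x ≡ₘ h → x ≡ₘ h % suc N'
    ≡ₘ-% {h = h} x≡h = ≡ₘ-trans x≡h (ι-≡ₘ-% h)

    recip-≡ₘ : ∀ k i → (k ℕ.* i) % suc N' ≡ 1 → ¬ p ∣ k × recip k ≡ₘ i
    recip-≡ₘ zero    i ()
    recip-≡ₘ (suc k) i ki≡1 = p∤k , congruent (Val≥-resp (≃-sym R-I≃) (Val≥-neg (Val≥-* (Val≥-multiple t p^E∣N) (Val≥-recip p∤k))))
      where
      open QP.≃-Reasoning
      t = suc k ℕ.* i / suc N'
      ki≡1+tN : suc k ℕ.* i ≡ 1 ℕ.+ t ℕ.* suc N'
      ki≡1+tN = trans (m≡m%n+[m/n]*n (suc k ℕ.* i) (suc N')) (cong (ℕ._+ t ℕ.* suc N') ki≡1)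
      p∤k : ¬ p ∣ suc k
      p∤k p∣k = p∤1 (ℕD.∣m+n∣m⇒∣n (subst (p ∣_) (trans ki≡1+tN (ℕP.+-comm 1 _)) (ℕD.∣-trans p∣k (ℕD.m∣m*n i)))
        (ℕD.∣-trans (ℕD.∣-trans p∣p^E p^E∣N) (ℕD.n∣m*n t)))
      R-I≃ : recip (suc k) Q.- ι i ≃ Q.- (ι (t ℕ.* suc N') Q.* recip (suc k))
      R-I≃ = begin
        R Q.- ι i                                    ≈⟨ QP.+-congʳ R (QP.-‿cong (≃-sym (≃-trans (QP.*-congˡ {ι i} (ι*recip (suc k))) (QP.*-identityʳ (ι i))))) ⟩
        R Q.- ι i Q.* (ι (suc k) Q.* R)              ≈⟨ reassociate R (ι i) (ι (suc k)) ⟩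
        R Q.- ι (suc k) Q.* ι i Q.* R                ≈⟨ QP.+-congʳ R (QP.-‿cong (QP.*-congʳ {R} ki≃1+tN)) ⟩
        R Q.- (1ℚᵘ Q.+ ι (t ℕ.* suc N')) Q.* R       ≈⟨ cancel-one R (ι (t ℕ.* suc N')) ⟩
        Q.- (ι (t ℕ.* suc N') Q.* R)                 ∎
        where
        R = recip (suc k)
        ki≃1+tN : ι (suc k) Q.* ι i ≃ 1ℚᵘ Q.+ ι (t ℕ.* suc N')
        ki≃1+tN = ≃-trans (≃-sym (ι-* (suc k) i)) (≃-trans (≃-reflexive (cong ι ki≡1+tN)) (ι-+ 1 _))
        reassociate : ∀ R I K → R Q.- I Q.* (K Q.* R) ≃ R Q.- K Q.* I Q.* R
        reassociate = solve 3 (λ R I K → R :- I :* (K :* R) := R :- K :* I :* R) ≃-refl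
        cancel-one : ∀ R T → R Q.- (1ℚᵘ Q.+ T) Q.* R ≃ Q.- (T Q.* R)
        cancel-one = solve 2 (λ R T → R :- (con 1ℚᵘ :+ T) :* R := :- (T :* R)) ≃-refl

    recip-power-step : ∀ {k i q} t → ¬ p ∣ k → recip k ≡ₘ i → recip (k ^ t) ≡ₘ q →
                       recip (k ^ suc t) ≡ₘ q ℕ.* i % suc N'
    recip-power-step {zero}  t p∤0 = ⊥-elim (p∤0 (p ℕD.∣0))
    recip-power-step {suc k} t p∤k k≡i kᵗ≡q = ≡ₘ-% (≡ₘ-resp split (≡ₘ-* (Val≥-recip p∤k) kᵗ≡q k≡i))
      where
      split : recip (suc k ^ t) Q.* recip (suc k) ≃ recip (suc k ^ suc t)
      split = ≃-trans (QP.*-comm (recip (suc k ^ t)) (recip (suc k)))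
        (≃-sym (recip-* (suc k) (suc k ^ t) {{_}} {{ℕP.m^n≢0 (suc k) t}}))

    recip-power : ∀ {k i} t → ¬ p ∣ k → recip k ≡ₘ i → recip (k ^ t) ≡ₘ powModNaive N' i t
    recip-power zero    p∤k k≡i = ≡ₘ-refl ≃-refl
    recip-power (suc t) p∤k k≡i = recip-power-step t p∤k k≡i (recip-power t p∤k k≡i)

    Table-% : ∀ k s hs → Table k s hs → Table k s (map (_% suc N') hs)
    Table-% k s []       tt         = tt
    Table-% k s (h ∷ hs) (h≡ , hs≡) = ≡ₘ-% h≡ , Table-% k (suc s) hs hs≡

    Table-addPowers : ∀ {k i} t q hs → ¬ p ∣ suc k → recip (suc k) ≡ₘ i → recip (suc k ^ t) ≡ₘ q →
                      Table k (suc t) hs → Table (suc k) (suc t) (addPowers N' i q hs)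
    Table-addPowers t q []       p∤k k≡i kᵗ≡q tt         = tt
    Table-addPowers t q (h ∷ hs) p∤k k≡i kᵗ≡q (h≡ , hs≡) =
      ≡ₘ-% (≡ₘ-+ h≡ next) , Table-addPowers (suc t) _ hs p∤k k≡i next hs≡
      where next = recip-power-step t p∤k k≡i kᵗ≡q

    length-addPowers : ∀ i q hs → length (addPowers N' i q hs) ≡ length hs
    length-addPowers i q []       = refl
    length-addPowers i q (h ∷ hs) = cong suc (length-addPowers i ((q ℕ.* i) % suc N') hs)

    productMod-indivisible : ∀ acc hs → ¬ p ^ E ∣ productMod N' acc hs → ¬ p ^ E ∣ acc × All (λ h → ¬ p ^ E ∣ h) hs
    productMod-indivisible acc []       p^E∤ = p^E∤ , []
    productMod-indivisible acc (h ∷ hs) p^E∤ with productMod-indivisible ((acc ℕ.* h) % suc N') hs p^E∤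
    ... | p^E∤acc·h , rest =
      (λ p^E∣acc → p^E∤acc·h (ℕD.%-presˡ-∣ (ℕD.∣-trans p^E∣acc (ℕD.m∣m*n h)) p^E∣N)) ,
      (λ p^E∣h → p^E∤acc·h (ℕD.%-presˡ-∣ (ℕD.∣-trans p^E∣h (ℕD.n∣m*n acc)) p^E∣N)) ∷ rest

    primeOK-sound : ∀ k hs → T (primeOK p E k hs (productMod N' 1 hs)) → AllCertified k 2 hs
    primeOK-sound k hs ok with split-∨ (proj₂ (split-∧ ok))
    ... | inj₁ p^E∤π = low+indivisible⇒certified k 2 hs (lowOK-sound k 2 hs (proj₁ (split-∧ ok)))
                         (proj₂ (productMod-indivisible 1 hs (dividesᵇ-false _ _ p^E∤π)))
    ... | inj₂ full  = fullOK-sound k 2 hs full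

  p^E∣modulus : ∀ {ps} → (p , E) ∈ ps → p ^ E ∣ modulus ps
  p^E∣modulus {(_ , _) ∷ ps} (here refl) = ℕD.m∣m*n (modulus ps)
  p^E∣modulus {(q , F) ∷ ps} (there p∈) = ℕD.∣-trans (p^E∣modulus p∈) (ℕD.n∣m*n (q ^ F))

  allPrimesOK-sound : ∀ {ps k hs π} → (p , E) ∈ ps → T (allPrimesOK ps k hs π) → T (primeOK p E k hs π)
  allPrimesOK-sound (here refl) ok = proj₁ (split-∧ ok)
  allPrimesOK-sound (there p∈)  ok = allPrimesOK-sound p∈ (proj₂ (split-∧ ok))

  CheckedUpTo : ℕ → Set
  CheckedUpTo K = ∀ m → 1 ≤ m → m ≤ K → Checked m

  checkedUpTo-step : ∀ {k} → CheckedUpTo k → Checked (suc k) → CheckedUpTo (suc k)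
  checkedUpTo-step done next m 1≤m m≤1+k with ℕP.m≤n⇒m<n∨m≡n m≤1+k
  ... | inj₁ m<1+k = done m 1≤m (ℕP.≤-pred m<1+k)
  ... | inj₂ refl  = next

  -- Soundness of the scan: the invariant is that hs is the table at index k modulo
  -- N = modulus ps, and that the indices up to k are checked.
  scan-sound : ∀ ps N' invs c k hs → T (scan ps N' invs c k hs) → (p , E) ∈ ps → suc N' ≡ modulus ps →
               smallestPrime ps ∸ 1 ≤ c ℕ.+ k → Table k 2 hs → length hs ≡ 299 →
               CheckedUpTo k → CheckedUpTo (p ∸ 1)
  restart-sound : ∀ ps k hs → T (restart ps k hs) → (p , E) ∈ ps → Table k 2 hs → length hs ≡ 299 →
                  CheckedUpTo k → CheckedUpTo (p ∸ 1)

  scan-sound (_ ∷ ps) N' invs zero k hs ok (here refl) N≡ p-1≤k tbl len done m 1≤m m≤p-1 =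
    done m 1≤m (ℕP.≤-trans m≤p-1 p-1≤k)
  scan-sound (_ ∷ ps) N' invs zero k hs ok (there p∈) N≡ _ tbl len done = restart-sound ps k hs ok p∈ tbl len done
  scan-sound (x ∷ ps) N' (i ∷ invs) (suc c) k hs ok p∈ N≡ last tbl len done
    with (suc k ℕ.* i) % suc N' ℕ.≡ᵇ 1 in inverse-ok
  ... | true = scan-sound (x ∷ ps) N' invs c (suc k) hs′ (proj₂ checks) p∈ N≡
                 (subst (smallestPrime (x ∷ ps) ∸ 1 ≤_) (sym (ℕP.+-suc c k)) last) tbl′ len′
                 (checkedUpTo-step done (table⇒checked (suc k) hs′ tbl′ certified len′))
    where
    p^E∣N : p ^ E ∣ suc N'
    p^E∣N = subst (p ^ E ∣_) (sym N≡) (p^E∣modulus p∈)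
    open Modulo N' p^E∣N
    hs′ = addPowers N' i i hs
    checks : T (allPrimesOK (x ∷ ps) (suc k) hs′ (productMod N' 1 hs′)) × T (scan (x ∷ ps) N' invs c (suc k) hs′)
    checks = split-∧ ok
    inverse : ¬ p ∣ suc k × recip (suc k) ≡ₘ i
    inverse = recip-≡ₘ (suc k) i (ℕP.≡ᵇ⇒≡ _ _ (subst T (sym inverse-ok) tt))
    tbl′ : Table (suc k) 2 hs′
    tbl′ = Table-addPowers 1 i hs (proj₁ inverse) (proj₂ inverse)
      (≡ₘ-resp (≃-reflexive (cong recip (sym (ℕP.*-identityʳ (suc k))))) (proj₂ inverse)) tbl
    len′ : length hs′ ≡ 299
    len′ = trans (length-addPowers i i hs) len
    certified : AllCertified (suc k) 2 hs′
    certified = primeOK-sound (suc k) hs′ (allPrimesOK-sound p∈ (proj₁ checks))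

  restart-sound ps k hs ok p∈ tbl len done with modulus ps in N≡
  ... | suc N' = scan-sound ps N' _ c k (map (_% suc N') hs) ok p∈ (sym N≡) c+k
                   (Table-% k 2 hs tbl) (trans (ListP.length-map _ hs) len) done
    where
    open Modulo N' (subst (p ^ E ∣_) N≡ (p^E∣modulus p∈))
    c = smallestPrime ps ∸ 1 ∸ k
    c+k : smallestPrime ps ∸ 1 ≤ c ℕ.+ k
    c+k = subst (smallestPrime ps ∸ 1 ≤_) (ℕP.+-comm k c) (ℕP.m≤n+m∸n (smallestPrime ps ∸ 1) k)

  checkBatch-sound : ∀ ps → T (checkBatch ps) → (p , E) ∈ ps → ∀ m → 1 ≤ m → m < p → Checked m
  checkBatch-sound ps ok p∈ m 1≤m m<p =
    restart-sound ps 0 (replicate 299 0) ok p∈ (Table-zero 299 2) (ListP.length-replicate 299 {0}) nothing-yet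
      m 1≤m (ℕP.<⇒≤pred m<p)
    where
    nothing-yet : CheckedUpTo 0
    nothing-yet m 1≤m m≤0 = ⊥-elim (ℕP.<⇒≱ 1≤m m≤0)

module Evaluation (p : ℕ) (isPrime : Prime p) (s E : ℕ) (1≤E : 1 ≤ E) (N' φ-1 : ℕ) (p^E∣N : p ^ E ∣ suc N') where
  open Valuation p isPrime
  open Descent p isPrime s
  open Congruence p isPrime E 1≤E
  open Modulo N' p^E∣N

  addInversePower-sound : ∀ {x h₀ h} k → x ≡ₘ h₀ → addInversePower N' φ-1 s k (just h₀) ≡ just h →
                          x Q.+ recip (k ^ s) ≡ₘ h
  addInversePower-sound {x} {h₀} k x≡h₀ added with (k ℕ.* powMod 200 N' k φ-1 1) % suc N' ℕ.≡ᵇ 1 in inverse-ok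
  ... | true with refl ← added = ≡ₘ-% (≡ₘ-+ x≡h₀ (recip-power s p∤k k≡i))
    where
    inverse = recip-≡ₘ k (powMod 200 N' k φ-1 1) (ℕP.≡ᵇ⇒≡ _ _ (subst T (sym inverse-ok) tt))
    p∤k = proj₁ inverse
    k≡i = proj₂ inverse

  evalX-sound : ∀ q r → r < p → ∀ {h} → evalX p N' φ-1 s q r ≡ just h → X q r ≡ₘ h
  evalX-sound zero    zero    _ refl = ≡ₘ-refl (QP.+-congʳ 0ℚᵘ (QP.-‿cong (QP.*-zeroʳ p⁻ˢ)))
  evalX-sound (suc q) zero    _ eval≡ = ≡ₘ-resp (≃-sym (X-carry q)) (evalX-sound q (p ∸ 1) p∸1<p eval≡)
  evalX-sound q       (suc r) r<p eval≡ with evalX p N' φ-1 s q r in previous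
  ... | just h₀ = ≡ₘ-resp (≃-sym (X-step q r))
    (addInversePower-sound (suc (q ℕ.* p ℕ.+ r)) (evalX-sound q r (ℕP.<-trans (ℕP.n<1+n r) r<p) previous) eval≡)

module Children (p : ℕ) (isPrime : Prime p) (s : ℕ) (2≤s : 2 ≤ s) where
  open Valuation p isPrime
  open Descent p isPrime s
  module C₂ = Congruence p isPrime 2 (s≤s z≤n)
  module Cₛ₊₂ = Congruence p isPrime (s ℕ.+ 2) (ℕP.≤-trans (s≤s z≤n) (ℕP.m≤n+m 2 s))

  -- H(s; mp+r) = X m r + p^{-s} H(s;m); if H(s;m) ≡ p^s·c′ (mod p^(s+2)) and
  -- X m r ≡ a (mod p²) this is ≡ a + c′ (mod p²), which is nonzero mod p² by assumption.
  child-not-bad : ∀ m c′ r a → Hᵘ s m Cₛ₊₂.≡ₘ p ^ s ℕ.* c′ → X m r C₂.≡ₘ a → ¬ p ^ 2 ∣ a ℕ.+ c′ →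
                  ¬ Val≥ s (Hᵘ s (m ℕ.* p ℕ.+ r))
  child-not-bad m c′ r a (Cₛ₊₂.congruent d) X≡a p²∤ bad = p²∤ (Val≥-ι-difference (Val≥-weaken 2≤s bad) (C₂.difference H≡))
    where
    open QP.≃-Reasoning
    scaled : p⁻ˢ Q.* Hᵘ s m C₂.≡ₘ c′
    scaled = C₂.congruent (Val≥-resp (begin
      p⁻ˢ Q.* (Hᵘ s m Q.- ι (p ^ s ℕ.* c′))          ≈⟨ QP.*-distribˡ-+ p⁻ˢ (Hᵘ s m) _ ⟩
      p⁻ˢ Q.* Hᵘ s m Q.+ p⁻ˢ Q.* Q.- ι (p ^ s ℕ.* c′)  ≈⟨ QP.+-congʳ (p⁻ˢ Q.* Hᵘ s m) (≃-trans (≃-sym (QP.neg-distribʳ-* p⁻ˢ _)) (QP.-‿cong unscale)) ⟩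
      p⁻ˢ Q.* Hᵘ s m Q.- ι c′                        ∎) (Val≥-recip-p^-shift s d))
      where
      unscale : p⁻ˢ Q.* ι (p ^ s ℕ.* c′) ≃ ι c′
      unscale = ≃-trans (QP.*-congˡ {p⁻ˢ} (ι-* (p ^ s) c′)) (recip-ι-cancel (p ^ s) {{ℕP.m^n≢0 p s}} (ι c′))
    H≡ : Hᵘ s (m ℕ.* p ℕ.+ r) C₂.≡ₘ a ℕ.+ c′
    H≡ = C₂.≡ₘ-resp (recombine (Hᵘ s (m ℕ.* p ℕ.+ r)) (p⁻ˢ Q.* Hᵘ s m)) (C₂.≡ₘ-+ X≡a scaled)
      where
      recombine : ∀ A B → (A Q.- B) Q.+ B ≃ A
      recombine = solve 2 (λ A B → (A :- B) :+ B := A) ≃-refl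

  p^e∣suc-pred : ∀ e → p ^ e ∣ suc (pred (p ^ e))
  p^e∣suc-pred e = subst (p ^ e ∣_) (sym (ℕP.suc-pred (p ^ e) {{ℕP.m^n≢0 p e}})) ℕD.∣-refl

  module Eₛ₊₂ = Evaluation p isPrime s (s ℕ.+ 2) (ℕP.≤-trans (s≤s z≤n) (ℕP.m≤n+m 2 s))
    (pred (p ^ (s ℕ.+ 2))) (pred (p ^ (s ℕ.+ 1) ℕ.* pred p)) (p^e∣suc-pred (s ℕ.+ 2))
  module E₂ = Evaluation p isPrime s 2 (s≤s z≤n) (pred (p ^ 2)) (pred (p ℕ.* pred p)) (p^e∣suc-pred 2)

  childrenOK-sound : ∀ m → m < p → T (childrenOK p s m) → ∀ r → r < p → ¬ Val≥ s (Hᵘ s (m ℕ.* p ℕ.+ r))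
  childrenOK-sound m m<p ok r r<p
    with evalX p (pred (p ^ (s ℕ.+ 2))) (pred (p ^ (s ℕ.+ 1) ℕ.* pred p)) s 0 m in evaluated
  ... | just c = from-child _ refl (allBelow-sound p _ (proj₂ (split-∧ ok)) r r<p)
    where
    c′ = c / suc (pred (p ^ s))
    Hm≡ : Hᵘ s m Cₛ₊₂.≡ₘ p ^ s ℕ.* c′
    Hm≡ = subst (Hᵘ s m Cₛ₊₂.≡ₘ_) (ℕP.≡ᵇ⇒≡ _ _ (proj₁ (split-∧ ok)))
      (Cₛ₊₂.≡ₘ-resp (≃-trans (QP.+-congʳ (Hᵘ s m) (QP.-‿cong (QP.*-zeroʳ p⁻ˢ))) (QP.+-identityʳ (Hᵘ s m)))
        (Eₛ₊₂.evalX-sound 0 m m<p evaluated))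
    from-child : ∀ v → evalX p (pred (p ^ 2)) (pred (p ℕ.* pred p)) s m r ≡ v → T (childOK p s c′ v) →
                 ¬ Val≥ s (Hᵘ s (m ℕ.* p ℕ.+ r))
    from-child (just a) evaluated-child child-ok =
      child-not-bad m c′ r a Hm≡ (E₂.evalX-sound m r r<p evaluated-child) (dividesᵇ-false _ _ child-ok)

module Certificates where
  open import Data.Bool.Base using (if_then_else_)

  batch₀ : List (ℕ × ℕ)
  batch₀ =
    (2 , 2) ∷ (3 , 7) ∷ (5 , 6) ∷ (7 , 5) ∷ (11 , 5) ∷ (13 , 5) ∷ (17 , 5) ∷ (19 , 4) ∷ (23 , 4) ∷ (29 , 4) ∷
    (31 , 4) ∷ (37 , 5) ∷ (41 , 4) ∷ (43 , 4) ∷ (47 , 4) ∷ (53 , 4) ∷ (59 , 4) ∷ (61 , 4) ∷ (67 , 4) ∷ (71 , 4) ∷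
    (73 , 4) ∷ (79 , 4) ∷ (83 , 4) ∷ (89 , 4) ∷ (97 , 4) ∷ (101 , 4) ∷ (103 , 4) ∷ (107 , 4) ∷ (109 , 4) ∷ (113 , 4) ∷
    (127 , 4) ∷ (131 , 4) ∷ (137 , 4) ∷ (139 , 4) ∷ (149 , 4) ∷ (151 , 4) ∷ (157 , 4) ∷ (163 , 4) ∷ (167 , 4) ∷ (173 , 4) ∷
    (179 , 4) ∷ (181 , 4) ∷ (191 , 4) ∷ (193 , 4) ∷ (197 , 4) ∷ (199 , 4) ∷ (211 , 4) ∷ (223 , 4) ∷ (227 , 4) ∷ (229 , 4) ∷
    (233 , 4) ∷ (239 , 4) ∷ (241 , 4) ∷ (251 , 4) ∷ (257 , 4) ∷ (263 , 4) ∷ (269 , 4) ∷ (271 , 4) ∷ (277 , 4) ∷ (281 , 4) ∷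
    (283 , 4) ∷ (293 , 4) ∷ (307 , 4) ∷ (311 , 4) ∷ (313 , 3) ∷ (317 , 3) ∷ (331 , 3) ∷ (337 , 3) ∷ (347 , 4) ∷ (349 , 3) ∷
    (353 , 4) ∷ (359 , 3) ∷ (367 , 3) ∷ (373 , 3) ∷ (379 , 4) ∷ (383 , 3) ∷ (389 , 4) ∷ (397 , 3) ∷ (401 , 4) ∷ (409 , 4) ∷
    (419 , 3) ∷ (421 , 4) ∷ (431 , 3) ∷ (433 , 4) ∷ (439 , 3) ∷ (443 , 3) ∷ (449 , 3) ∷ (457 , 3) ∷ (461 , 4) ∷ (463 , 3) ∷
    (467 , 4) ∷ (479 , 3) ∷ (487 , 3) ∷ (491 , 4) ∷ (499 , 3) ∷ (503 , 3) ∷ (509 , 3) ∷ (521 , 3) ∷ (523 , 4) ∷ (541 , 3) ∷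
    (547 , 4) ∷ (557 , 3) ∷ (563 , 3) ∷ (569 , 3) ∷ (571 , 3) ∷ (577 , 3) ∷ (587 , 3) ∷ (593 , 3) ∷ (599 , 3) ∷ []

  batch₁ : List (ℕ × ℕ)
  batch₁ =
    (601 , 3) ∷ (607 , 4) ∷ (613 , 4) ∷ (617 , 4) ∷ (619 , 4) ∷ (631 , 3) ∷ (641 , 3) ∷ (643 , 3) ∷ (647 , 4) ∷ (653 , 3) ∷
    (659 , 3) ∷ (661 , 3) ∷ (673 , 4) ∷ (677 , 4) ∷ (683 , 3) ∷ (691 , 3) ∷ (701 , 3) ∷ (709 , 3) ∷ (719 , 3) ∷ (727 , 3) ∷
    (733 , 3) ∷ (739 , 3) ∷ (743 , 3) ∷ (751 , 3) ∷ (757 , 4) ∷ (761 , 3) ∷ (769 , 3) ∷ (773 , 4) ∷ (787 , 3) ∷ (797 , 3) ∷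
    (809 , 4) ∷ (811 , 4) ∷ (821 , 4) ∷ (823 , 3) ∷ (827 , 3) ∷ (829 , 3) ∷ (839 , 3) ∷ (853 , 3) ∷ (857 , 3) ∷ (859 , 3) ∷
    (863 , 3) ∷ (877 , 4) ∷ (881 , 3) ∷ (883 , 3) ∷ (887 , 3) ∷ (907 , 3) ∷ (911 , 3) ∷ (919 , 3) ∷ (929 , 4) ∷ (937 , 3) ∷
    (941 , 3) ∷ (947 , 3) ∷ (953 , 3) ∷ (967 , 3) ∷ (971 , 3) ∷ (977 , 3) ∷ (983 , 3) ∷ (991 , 3) ∷ (997 , 3) ∷ (1009 , 3) ∷
    (1013 , 3) ∷ (1019 , 3) ∷ (1021 , 3) ∷ (1031 , 3) ∷ (1033 , 3) ∷ (1039 , 3) ∷ (1049 , 3) ∷ (1051 , 3) ∷ (1061 , 3) ∷ (1063 , 3) ∷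
    (1069 , 3) ∷ (1087 , 3) ∷ (1091 , 4) ∷ (1093 , 3) ∷ (1097 , 3) ∷ (1103 , 3) ∷ (1109 , 3) ∷ (1117 , 3) ∷ (1123 , 3) ∷ (1129 , 3) ∷
    (1151 , 4) ∷ (1153 , 3) ∷ (1163 , 3) ∷ (1171 , 3) ∷ (1181 , 3) ∷ (1187 , 3) ∷ (1193 , 3) ∷ (1201 , 3) ∷ (1213 , 3) ∷ (1217 , 4) ∷
    (1223 , 3) ∷ (1229 , 3) ∷ (1231 , 3) ∷ (1237 , 3) ∷ (1249 , 3) ∷ (1259 , 3) ∷ []

  batch₂ : List (ℕ × ℕ)
  batch₂ =
    (1277 , 3) ∷ (1279 , 3) ∷ (1283 , 3) ∷ (1289 , 3) ∷ (1291 , 3) ∷ (1297 , 3) ∷ (1301 , 3) ∷ (1303 , 3) ∷ (1307 , 3) ∷ (1319 , 3) ∷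
    (1321 , 3) ∷ (1327 , 3) ∷ (1361 , 3) ∷ (1367 , 3) ∷ (1373 , 3) ∷ (1381 , 3) ∷ (1399 , 3) ∷ (1409 , 3) ∷ (1423 , 3) ∷ (1427 , 3) ∷
    (1429 , 3) ∷ (1433 , 3) ∷ (1439 , 3) ∷ (1447 , 3) ∷ (1451 , 3) ∷ (1453 , 3) ∷ (1459 , 3) ∷ (1471 , 3) ∷ (1481 , 3) ∷ (1483 , 3) ∷
    (1487 , 3) ∷ (1489 , 3) ∷ (1493 , 3) ∷ (1499 , 3) ∷ (1511 , 3) ∷ (1523 , 4) ∷ (1531 , 3) ∷ (1543 , 3) ∷ (1549 , 3) ∷ (1553 , 3) ∷
    (1559 , 3) ∷ (1567 , 3) ∷ (1571 , 3) ∷ (1579 , 3) ∷ (1583 , 3) ∷ (1597 , 3) ∷ (1601 , 3) ∷ (1607 , 3) ∷ (1609 , 4) ∷ (1613 , 3) ∷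
    (1619 , 3) ∷ (1621 , 3) ∷ (1627 , 3) ∷ (1637 , 3) ∷ (1657 , 3) ∷ (1663 , 4) ∷ (1667 , 3) ∷ (1669 , 3) ∷ (1693 , 3) ∷ (1697 , 3) ∷
    (1699 , 3) ∷ (1709 , 3) ∷ (1721 , 3) ∷ (1723 , 3) ∷ (1733 , 3) ∷ (1741 , 3) ∷ (1747 , 3) ∷ (1753 , 3) ∷ (1759 , 4) ∷ (1777 , 3) ∷
    (1783 , 3) ∷ (1787 , 4) ∷ (1789 , 3) ∷ (1801 , 3) ∷ (1811 , 4) ∷ (1823 , 3) ∷ (1831 , 3) ∷ (1847 , 4) ∷ (1861 , 3) ∷ (1867 , 3) ∷
    (1871 , 4) ∷ (1873 , 3) ∷ (1877 , 3) ∷ (1879 , 3) ∷ (1889 , 3) ∷ (1901 , 4) ∷ (1907 , 3) ∷ (1913 , 3) ∷ (1931 , 3) ∷ (1933 , 3) ∷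
    (1949 , 3) ∷ []

  batch₃ : List (ℕ × ℕ)
  batch₃ =
    (1951 , 4) ∷ (1973 , 3) ∷ (1979 , 3) ∷ (1987 , 3) ∷ (1993 , 3) ∷ (1997 , 4) ∷ (1999 , 3) ∷ (2003 , 3) ∷ (2011 , 3) ∷ (2017 , 3) ∷
    (2027 , 3) ∷ (2029 , 3) ∷ (2039 , 3) ∷ (2053 , 4) ∷ (2063 , 3) ∷ (2069 , 3) ∷ (2081 , 3) ∷ (2083 , 3) ∷ (2087 , 3) ∷ (2089 , 3) ∷
    (2099 , 3) ∷ (2111 , 3) ∷ (2113 , 3) ∷ (2129 , 3) ∷ (2131 , 3) ∷ (2137 , 3) ∷ (2141 , 3) ∷ (2143 , 4) ∷ (2153 , 3) ∷ (2161 , 3) ∷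
    (2179 , 3) ∷ (2203 , 3) ∷ (2207 , 3) ∷ (2213 , 3) ∷ (2221 , 3) ∷ (2237 , 3) ∷ (2239 , 3) ∷ (2243 , 3) ∷ (2251 , 3) ∷ (2267 , 4) ∷
    (2269 , 3) ∷ (2273 , 4) ∷ (2281 , 3) ∷ (2287 , 3) ∷ (2293 , 4) ∷ (2297 , 3) ∷ (2309 , 3) ∷ (2311 , 3) ∷ (2333 , 3) ∷ (2339 , 3) ∷
    (2341 , 3) ∷ (2347 , 3) ∷ (2351 , 3) ∷ (2357 , 4) ∷ (2371 , 4) ∷ (2377 , 3) ∷ (2381 , 3) ∷ (2383 , 4) ∷ (2389 , 3) ∷ (2393 , 3) ∷
    (2399 , 3) ∷ (2411 , 4) ∷ (2417 , 3) ∷ (2423 , 3) ∷ (2437 , 3) ∷ (2441 , 3) ∷ (2447 , 3) ∷ (2459 , 3) ∷ (2467 , 3) ∷ (2473 , 3) ∷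
    (2477 , 3) ∷ (2503 , 3) ∷ (2521 , 3) ∷ (2531 , 3) ∷ (2539 , 3) ∷ (2543 , 4) ∷ (2549 , 3) ∷ (2551 , 3) ∷ (2557 , 3) ∷ (2579 , 3) ∷
    (2591 , 4) ∷ (2593 , 3) ∷ (2609 , 3) ∷ (2617 , 3) ∷ (2621 , 3) ∷ []

  batch₄ : List (ℕ × ℕ)
  batch₄ =
    (2633 , 3) ∷ (2647 , 3) ∷ (2657 , 3) ∷ (2659 , 3) ∷ (2663 , 3) ∷ (2671 , 4) ∷ (2677 , 3) ∷ (2683 , 3) ∷ (2687 , 3) ∷ (2689 , 3) ∷
    (2693 , 3) ∷ (2699 , 3) ∷ (2707 , 3) ∷ (2711 , 3) ∷ (2713 , 3) ∷ (2719 , 3) ∷ (2729 , 3) ∷ (2731 , 3) ∷ (2741 , 3) ∷ (2749 , 3) ∷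
    (2753 , 3) ∷ (2767 , 4) ∷ (2777 , 3) ∷ (2789 , 3) ∷ (2791 , 4) ∷ (2797 , 3) ∷ (2801 , 3) ∷ (2803 , 3) ∷ (2819 , 3) ∷ (2833 , 3) ∷
    (2837 , 3) ∷ (2843 , 3) ∷ (2851 , 3) ∷ (2857 , 3) ∷ (2861 , 3) ∷ (2879 , 3) ∷ (2887 , 3) ∷ (2897 , 3) ∷ (2903 , 3) ∷ (2909 , 3) ∷
    (2917 , 3) ∷ (2927 , 3) ∷ (2939 , 4) ∷ (2953 , 3) ∷ (2957 , 3) ∷ (2963 , 3) ∷ (2969 , 3) ∷ (2971 , 3) ∷ (2999 , 3) ∷ (3001 , 3) ∷ []

  batches : List (List (ℕ × ℕ))
  batches = batch₀ ∷ batch₁ ∷ batch₂ ∷ batch₃ ∷ batch₄ ∷ []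

  batches-ok : ∀ {ps} → ps ∈ batches → checkBatch ps ≡ true
  batches-ok (here refl)                                 = refl
  batches-ok (there (here refl))                         = refl
  batches-ok (there (there (here refl)))                 = refl
  batches-ok (there (there (there (here refl))))         = refl
  batches-ok (there (there (there (there (here refl))))) = refl

  exponentIn : ℕ → List (ℕ × ℕ) → Maybe ℕ
  exponentIn n []             = nothing
  exponentIn n ((q , E) ∷ ps) = if n ℕ.≡ᵇ q then just E else exponentIn n ps

  exponentIn-sound : ∀ n ps {E} → exponentIn n ps ≡ just E → (n , E) ∈ ps
  exponentIn-sound n ((q , F) ∷ ps) found with n ℕ.≡ᵇ q in n≡ᵇq
  ... | true  with refl ← found = here (cong (_, F) (ℕP.≡ᵇ⇒≡ n q (subst T (sym n≡ᵇq) tt)))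
  ... | false = there (exponentIn-sound n ps found)

  findBatch : ℕ → List (List (ℕ × ℕ)) → Maybe (List (ℕ × ℕ) × ℕ)
  findBatch′ : Maybe ℕ → List (ℕ × ℕ) → Maybe (List (ℕ × ℕ) × ℕ) → Maybe (List (ℕ × ℕ) × ℕ)
  findBatch n []        = nothing
  findBatch n (ps ∷ bs) = findBatch′ (exponentIn n ps) ps (findBatch n bs)
  findBatch′ (just E) ps _    = just (ps , E)
  findBatch′ nothing  ps rest = rest

  record Located (p : ℕ) : Set where
    field
      batch    : List (ℕ × ℕ)
      exponent : ℕ
      1≤E      : 1 ≤ exponent
      batch∈   : batch ∈ batches
      p∈       : (p , exponent) ∈ batch

  locatedᵇ : Maybe (List (ℕ × ℕ) × ℕ) → Bool
  locatedᵇ nothing        = false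
  locatedᵇ (just (_ , E)) = 1 ℕ.≤ᵇ E

  findBatch-sound : ∀ n bs {ps E} → findBatch n bs ≡ just (ps , E) → ps ∈ bs × (n , E) ∈ ps
  findBatch-sound n (ps′ ∷ bs) found with exponentIn n ps′ in found-here
  ... | just E′ with refl ← found = here refl , exponentIn-sound n ps′ found-here
  ... | nothing = map₁ there (findBatch-sound n bs found)

  located : ∀ n r → findBatch n batches ≡ r → T (locatedᵇ r) → Located n
  located n (just (ps , E)) found 1≤ᵇE = record
    { batch = ps ; exponent = E ; 1≤E = ℕP.≤ᵇ⇒≤ 1 E 1≤ᵇE
    ; batch∈ = proj₁ (findBatch-sound n batches found) ; p∈ = proj₂ (findBatch-sound n batches found) }

  hasFactorFrom : (n d f : ℕ) → Bool
  hasFactorFrom n d zero    = false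
  hasFactorFrom n d (suc f) = (dividesᵇ d n ∧ (d ℕ.<ᵇ n)) ∨ hasFactorFrom n (suc d) f

  hasFactorFrom-sound : ∀ n d f → 2 ≤ d → T (hasFactorFrom n d f) → ¬ Prime n
  hasFactorFrom-sound n d (suc f) 2≤d ok with split-∨ ok
  ... | inj₁ here′ = composite⇒¬prime (ℕD.hasNonTrivialDivisor {{ℕ.n>1⇒nonTrivial 2≤d}}
                       (ℕP.<ᵇ⇒< d n (proj₂ (split-∧ here′))) (dividesᵇ-true d n (proj₁ (split-∧ here′))))
  ... | inj₂ later = hasFactorFrom-sound n (suc d) f (ℕP.m≤n⇒m≤1+n 2≤d) later

  coveredᵇ : ℕ → Bool
  coveredᵇ n = (n ℕ.<ᵇ 2) ∨ (locatedᵇ (findBatch n batches) ∨ hasFactorFrom n 2 n)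

  all-covered : allBelow 3002 coveredᵇ ≡ true
  all-covered = refl

  locate : ∀ p → Prime p → p ≤ 3001 → Located p
  locate p isPrime p≤3001
    with split-∨ (allBelow-sound 3002 coveredᵇ (from-≡true (allBelow 3002 coveredᵇ) all-covered) p (s≤s p≤3001))
  ... | inj₁ p<2 = ⊥-elim (ℕP.<⇒≱ (ℕP.<ᵇ⇒< p 2 p<2) (ℕ.nonTrivial⇒n>1 p {{prime⇒nonTrivial isPrime}}))
  ... | inj₂ rest with split-∨ rest
  ... | inj₁ found     = located p _ refl found
  ... | inj₂ composite = ⊥-elim (hasFactorFrom-sound p 2 p ℕP.≤-refl composite isPrime)

  decode-triple : ∀ p s m p₀ s₀ m₀ → T ((p ℕ.≡ᵇ p₀) ∧ (s ℕ.≡ᵇ s₀) ∧ (m ℕ.≡ᵇ m₀)) → p ≡ p₀ × s ≡ s₀ × m ≡ m₀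
  decode-triple p s m p₀ s₀ m₀ ok with split-∧ ok
  ... | p≡ , rest with split-∧ rest
  ... | s≡ , m≡ = ℕP.≡ᵇ⇒≡ p p₀ p≡ , ℕP.≡ᵇ⇒≡ s s₀ s≡ , ℕP.≡ᵇ⇒≡ m m₀ m≡

  exceptional-cases : ∀ p s m → T (exceptional p s m) → (p ≡ 7 × s ≡ 2 × m ≡ 3) ⊎ (p ≡ 37 × s ≡ 3 × m ≡ 36)
  exceptional-cases p s m exc with split-∨ exc
  ... | inj₁ case₁ = inj₁ (decode-triple p s m 7 2 3 case₁)
  ... | inj₂ case₂ = inj₂ (decode-triple p s m 37 3 36 case₂)

  children-ok : childrenOK 7 2 3 ≡ true × childrenOK 37 3 36 ≡ true
  children-ok = refl , refl

  one-digit-bad⇒exceptional : ∀ p (isPrime : Prime p) → p ≤ 3001 → ∀ s → 2 ≤ s → s ≤ 300 →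
    ∀ m → 1 ≤ m → m < p → Valuation.Val≥ p isPrime s (Hᵘ s m) → T (exceptional p s m)
  one-digit-bad⇒exceptional p isPrime p≤3001 s 2≤s s≤300 m 1≤m m<p =
    Congruence.checkBatch-sound p isPrime exponent 1≤E batch (from-≡true (checkBatch batch) (batches-ok batch∈)) p∈ m 1≤m m<p s 2≤s s≤300
    where open Located (locate p isPrime p≤3001)

  exceptional⇒no-bad-child : ∀ p (isPrime : Prime p) s → 2 ≤ s →
    ∀ m → T (exceptional p s m) → ∀ r → r < p → ¬ Valuation.Val≥ p isPrime s (Hᵘ s (m ℕ.* p ℕ.+ r))
  exceptional⇒no-bad-child p isPrime s 2≤s m exc =
    Children.childrenOK-sound p isPrime s 2≤s m (proj₁ verified) (from-≡true (childrenOK p s m) (proj₂ verified))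
    where
    verified : m < p × childrenOK p s m ≡ true
    verified with exceptional-cases p s m exc
    ... | inj₁ (refl , refl , refl) = ℕP.<ᵇ⇒< 3 7 tt , proj₁ children-ok
    ... | inj₂ (refl , refl , refl) = ℕP.<ᵇ⇒< 36 37 tt , proj₂ children-ok

mainTheorem1 : (p s : ℕ) → Prime p → p ≤ 3001 → 2 ≤ s → s ≤ 300 →
    FiniteSet (J s p)
mainTheorem1 p s isPrime p≤3001 2≤s s≤300 = p ℕ.* p , λ n Jn →
  bad-parent⇒n<p² n (descent n (Val≥-resp (toℚᵘ-H s n) (zeroModP⇒Val≥1 (H s n) Jn)))
  where
  open Valuation p isPrime
  open Descent p isPrime s
  open Certificates
  open Pruning p 1<p (λ m → Val≥ s (Hᵘ s m)) (λ m → T (exceptional p s m))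
    (λ m bad → descent m (Val≥-weaken (ℕP.≤-trans (s≤s z≤n) 2≤s) bad))
    (one-digit-bad⇒exceptional p isPrime p≤3001 s 2≤s s≤300)
    (exceptional⇒no-bad-child p isPrime s 2≤s)
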